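{- There exist constants $c>0$ and $N$ such that every graph $G$ of order $n\ge N$ satisfies $\mathrm{adim}(G)\ge\mathrm{bdim}(G)\ge c\log n$; i.e., $\mathrm{adim}(G)\ge \mathrm{bdim}(G)=\Omega(\log n)$ for all graphs $G$ of order $n$.
   Context: All graphs are finite, simple and undirected. For vertices $x,y$ of $G$, $d(x,y)$ is the length of a shortest $x$–$y$ path ($\infty$ if in different components). For a positive integer $i$, $d_i(x,y)=\min\{d(x,y),i+1\}$. A set $S\subseteq V(G)$ is an adjacency resolving set if for any two distinct $x,y$ there is $z\in S$ with $d_1(x,z)\neq d_1(y,z)$; $\mathrm{adim}(G)$ is the minimum cardinality of such a set. A function $f:V(G)\to\mathbb{Z}_{\ge0}$ is a resolving broadcast if for any two distinct $x,y$ there is $z$ with $f(z)=i>0$ and $d_i(x,z)\neq d_i(y,z)$; $\mathrm{bdim}(G)$ is the minimum of $\sum_{v}f(v)$ over all resolving broadcasts $f$ of $G$. -}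

module Defs where

open import Data.Nat using (ℕ; zero; suc; _≤_; _<_)
open import Data.Bool using (Bool; true; false; _∨_; _∧_; if_then_else_)
open import Data.Fin using (Fin; _≟_)
open import Data.Fin.Subset using (Subset; _∈_; ∣_∣)
open import Data.List using (List; allFin; map)
open import Data.Bool.ListAction using (any)
open import Data.Nat.ListAction using (sum)
open import Data.Product using (Σ; _×_; ∃)
open import Relation.Nullary using (¬_)
open import Relation.Nullary.Decidable using (⌊_⌋)
open import Relation.Binary.PropositionalEquality using (_≡_; _≢_)

record Graph (n : ℕ) : Set where
  field
    adj    : Fin n → Fin n → Bool
    sym    : ∀ x y → adj x y ≡ adj y x
    irrefl : ∀ x → adj x x ≡ false
open Graph public

-- reach G k x y = true  iff  there is an x–y walk of length ≤ k, i.e. d(x,y) ≤ k.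
reach : ∀ {n} → Graph n → ℕ → Fin n → Fin n → Bool
reach G zero    x y = ⌊ x ≟ y ⌋
reach G (suc k) x y = reach G k x y ∨ any (λ z → reach G k x z ∧ adj G z y) (allFin _)

-- Truncated distance d_i(x,y) = min{ d(x,y), i+1 }  (d = ∞ across components).
dcap : ∀ {n} → Graph n → ℕ → Fin n → Fin n → ℕ
dcap G zero    x y = if reach G zero x y then zero else suc zero
dcap G (suc i) x y =
  if reach G i x y then dcap G i x y
  else (if reach G (suc i) x y then suc i else suc (suc i))

IsAdjResolving : ∀ {n} → Graph n → Subset n → Set
IsAdjResolving {n} G S =
  (x y : Fin n) → x ≢ y → ∃ λ z → (z ∈ S) × (dcap G 1 x z ≢ dcap G 1 y z)

IsAdim : ∀ {n} → Graph n → ℕ → Set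
IsAdim {n} G k =
  (Σ (Subset n) λ S → IsAdjResolving G S × ∣ S ∣ ≡ k)
  × ((S : Subset n) → IsAdjResolving G S → k ≤ ∣ S ∣)

IsResolvingBroadcast : ∀ {n} → Graph n → (Fin n → ℕ) → Set
IsResolvingBroadcast {n} G f =
  (x y : Fin n) → x ≢ y →
  ∃ λ z → (0 < f z) × (dcap G (f z) x z ≢ dcap G (f z) y z)

cost : ∀ {n} → (Fin n → ℕ) → ℕ
cost {n} f = sum (map f (allFin n))

IsBdim : ∀ {n} → Graph n → ℕ → Set
IsBdim {n} G k =
  (Σ (Fin n → ℕ) λ f → IsResolvingBroadcast G f × cost f ≡ k)
  × ((f : Fin n → ℕ) → IsResolvingBroadcast G f → k ≤ cost f)

module Submission where

-- Part (i), adim ≥ bdim: the indicator function of an adjacency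
-- resolving set S is a resolving broadcast (every vertex of S broadcasts with
-- strength 1, and d₁ is exactly what S observes), and its cost is ∣ S ∣.
-- Part (ii), bdim = Ω(log n): a broadcasting vertex z with f(z) = k > 0 sees
-- each vertex x through the truncated distance d_k(x,z) ∈ {0,…,k+1}, which
-- takes at most k + 2 ≤ 4^k values; a silent vertex (k = 0) sees nothing, one
-- value = 4^0.  So every vertex x gets a signature in ∏_z Fin(4^f(z)), a set
-- of size 4^(Σ_z f(z)) = 4^cost(f), and "f is resolving" says precisely that
-- the signature map is injective.  Hence n ≤ 4^bdim(G) = 2^(2·bdim(G)), i.e.
-- the theorem holds with c = 1/2 (p = 1, q = 2) and N = 0.

open import Defs hiding (sym)
open import Data.Nat using (ℕ; _≤_; _<_; _*_; _^_)
open import Data.Product using (Σ; _×_)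

open import Data.Nat using (zero; suc; _+_; z≤n; s≤s)
open import Data.Nat.Properties
  using (≤-refl; ≤-trans; n≤1+n; m≤n⇒m≤1+n; m≤m+n; +-mono-≤; m^n>0;
         *-identityʳ; ^-distribˡ-+-*; ^-*-assoc; module ≤-Reasoning)
open import Data.Nat.ListAction using (sum; product)
open import Data.Bool using (true; false; if_then_else_)
open import Data.Fin using (Fin; zero; suc; fromℕ<; combine; _≟_)
open import Data.Fin.Properties using (combine-injective; fromℕ<-injective; injective⇒≤)
open import Data.Fin.Subset using (Subset; ∣_∣)
open import Data.Vec using ([]; _∷_; lookup)
open import Data.Vec.Properties using ([]=⇒lookup)
open import Data.List using (List; []; _∷_; map; tabulate)
open import Data.List.Properties using (map-tabulate)
open import Data.Product using (_,_; proj₁; proj₂)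
open import Data.Empty using (⊥-elim)
open import Relation.Nullary using (yes; no)
open import Relation.Binary.PropositionalEquality

cost-tabulate : ∀ {n} (f : Fin n → ℕ) → cost f ≡ sum (tabulate f)
cost-tabulate f = cong sum (map-tabulate (λ z → z) f)

product-map-^ : ∀ b (xs : List ℕ) → product (map (b ^_) xs) ≡ b ^ sum xs
product-map-^ b []       = refl
product-map-^ b (x ∷ xs) = begin
  b ^ x * product (map (b ^_) xs) ≡⟨ cong (b ^ x *_) (product-map-^ b xs) ⟩
  b ^ x * b ^ sum xs              ≡⟨ sym (^-distribˡ-+-* b x (sum xs)) ⟩
  b ^ (x + sum xs)                ∎
  where open ≡-Reasoning

encode : ∀ {m} (B : Fin m → ℕ) → ((z : Fin m) → Fin (B z)) → Fin (product (tabulate B))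
encode {zero}  B c = zero
encode {suc m} B c = combine (c zero) (encode (λ z → B (suc z)) (λ z → c (suc z)))

encode-injective : ∀ {m} (B : Fin m → ℕ) (c c′ : (z : Fin m) → Fin (B z)) →
                   encode B c ≡ encode B c′ → ∀ z → c z ≡ c′ z
encode-injective {suc m} B c c′ eq zero    =
  proj₁ (combine-injective (c zero) _ (c′ zero) _ eq)
encode-injective {suc m} B c c′ eq (suc z) =
  encode-injective (λ z → B (suc z)) (λ z → c (suc z)) (λ z → c′ (suc z))
    (proj₂ (combine-injective (c zero) _ (c′ zero) _ eq)) z

dcap-≤ : ∀ {n} (G : Graph n) i x y → dcap G i x y ≤ suc i
dcap-≤ G zero x y with reach G zero x y
... | true  = z≤n
... | false = ≤-refl
dcap-≤ G (suc i) x y with reach G i x y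
... | true  = m≤n⇒m≤1+n (dcap-≤ G i x y)
... | false = if-≤ _
  where
    if-≤ : ∀ b → (if b then suc i else suc (suc i)) ≤ suc (suc i)
    if-≤ true  = n≤1+n (suc i)
    if-≤ false = ≤-refl

3+k≤4^[1+k] : ∀ k → 3 + k ≤ 4 ^ suc k
3+k≤4^[1+k] zero    = s≤s (s≤s (s≤s z≤n))
3+k≤4^[1+k] (suc k) =
  +-mono-≤ (m^n>0 4 (suc k)) (≤-trans (3+k≤4^[1+k] k) (m≤m+n (4 ^ suc k) _))

reading : ∀ {n} → Graph n → (k : ℕ) → Fin n → Fin n → Fin (4 ^ k)
reading G zero    x z = zero
reading G (suc k) x z = fromℕ< (≤-trans (s≤s (dcap-≤ G (suc k) x z)) (3+k≤4^[1+k] k))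

reading-separates : ∀ {n} (G : Graph n) k x y z → 0 < k →
                    dcap G k x z ≢ dcap G k y z → reading G k x z ≢ reading G k y z
reading-separates G (suc k) x y z _ dx≢dy eq = dx≢dy (fromℕ<-injective _ _ _ _ eq)

signature : ∀ {n} → Graph n → (f : Fin n → ℕ) → Fin n → (z : Fin n) → Fin (4 ^ f z)
signature G f x z = reading G (f z) x z

signature-injective : ∀ {n} (G : Graph n) (f : Fin n → ℕ) → IsResolvingBroadcast G f →
                      ∀ x y → encode (λ z → 4 ^ f z) (signature G f x)
                            ≡ encode (λ z → 4 ^ f z) (signature G f y) → x ≡ y
signature-injective G f resolving x y eq with x ≟ y
... | yes x≡y = x≡y
... | no  x≢y with resolving x y x≢y
...   | z , 0<fz , dx≢dy = ⊥-elim (reading-separates G (f z) x y z 0<fz dx≢dy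
                                     (encode-injective _ _ _ eq z))

order≤4^cost : ∀ {n} (G : Graph n) (f : Fin n → ℕ) → IsResolvingBroadcast G f →
               n ≤ 4 ^ cost f
order≤4^cost {n} G f resolving = begin
  n                                  ≤⟨ injective⇒≤ (signature-injective G f resolving _ _) ⟩
  product (tabulate (λ z → 4 ^ f z)) ≡⟨ cong product (map-tabulate f (4 ^_)) ⟨
  product (map (4 ^_) (tabulate f))  ≡⟨ product-map-^ 4 (tabulate f) ⟩
  4 ^ sum (tabulate f)               ≡⟨ cong (4 ^_) (cost-tabulate f) ⟨
  4 ^ cost f                         ∎
  where open ≤-Reasoning

indicator : ∀ {n} → Subset n → Fin n → ℕ
indicator S z = if lookup S z then 1 else 0

cost-indicator : ∀ {n} (S : Subset n) → cost (indicator S) ≡ ∣ S ∣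
cost-indicator S = trans (cost-tabulate (indicator S)) (sum-indicator S)
  where
    sum-indicator : ∀ {n} (S : Subset n) → sum (tabulate (indicator S)) ≡ ∣ S ∣
    sum-indicator []          = refl
    sum-indicator (true  ∷ S) = cong suc (sum-indicator S)
    sum-indicator (false ∷ S) = sum-indicator S

adjResolving⇒resolvingBroadcast : ∀ {n} (G : Graph n) (S : Subset n) →
  IsAdjResolving G S → IsResolvingBroadcast G (indicator S)
adjResolving⇒resolvingBroadcast G S resolving x y x≢y
  with resolving x y x≢y
... | z , z∈S , d₁x≢d₁y =
  z , subst (0 <_) (sym strength-1) (s≤s z≤n) ,
  subst (λ k → dcap G k x z ≢ dcap G k y z) (sym strength-1) d₁x≢d₁y
  where
    strength-1 : indicator S z ≡ 1
    strength-1 rewrite []=⇒lookup z∈S = refl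

bdim≤adim : ∀ {n} (G : Graph n) (a b : ℕ) → IsAdim G a → IsBdim G b → b ≤ a
bdim≤adim G a b ((S , S-resolving , ∣S∣≡a) , _) (_ , b-minimal) = begin
  b                  ≤⟨ b-minimal (indicator S) (adjResolving⇒resolvingBroadcast G S S-resolving) ⟩
  cost (indicator S) ≡⟨ cost-indicator S ⟩
  ∣ S ∣              ≡⟨ ∣S∣≡a ⟩
  a                  ∎
  where open ≤-Reasoning

order≤2^[2·bdim] : ∀ {n} (G : Graph n) (b : ℕ) → IsBdim G b → n ≤ 2 ^ (2 * b)
order≤2^[2·bdim] {n} G b ((f , f-resolving , cost≡b) , _) = begin
  n           ≤⟨ order≤4^cost G f f-resolving ⟩
  4 ^ cost f  ≡⟨ cong (4 ^_) cost≡b ⟩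
  4 ^ b       ≡⟨ ^-*-assoc 2 2 b ⟩
  2 ^ (2 * b) ∎
  where open ≤-Reasoning

theorem3p16 : Σ ℕ λ p → Σ ℕ λ q → (0 < p) × (0 < q) × (Σ ℕ λ N →
    (n : ℕ) → N ≤ n → (G : Graph n) → (a b : ℕ) →
    IsAdim G a → IsBdim G b → (b ≤ a) × (n ^ p ≤ 2 ^ (q * b)))
theorem3p16 = 1 , 2 , s≤s z≤n , s≤s z≤n , 0 , λ n _ G a b adim bdim →
  bdim≤adim G a b adim bdim ,
  subst (_≤ 2 ^ (2 * b)) (sym (*-identityʳ n)) (order≤2^[2·bdim] G b bdim)
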